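{- Let $a,b,y$ be parameters (complex numbers with $y\neq1$, or indeterminates), and let $(\mu_n)_{n\ge0}$ be the sequence with exponential generating function $$\sum_{n\ge0}\mu_n\frac{x^n}{n!}=E(x,y;a,b)=\frac{(1-y)\,e^{a x(1-y)}}{1-y\,e^{bx(1-y)}}.$$ Then its ordinary generating function is $$\sum_{n\ge0}\mu_n x^n=\mathcal{J}\bigl(y(b-a)+a,\; y(b-a)+a+b(1+y),\; y(b-a)+a+2b(1+y),\;\ldots;\; b^2y,\;4b^2y,\;9b^2y,\ldots\bigr),$$ i.e. the $n$-th coefficient of the first list is $y(b-a)+a+nb(1+y)$ ($n\ge0$) and the $n$-th coefficient of the second list is $n^2b^2y$ ($n\ge1$).
   Context: Notation $\mathcal{J}$: for sequences $(c_0,c_1,c_2,\ldots)$ and $(d_1,d_2,\ldots)$, $\mathcal{J}(c_0,c_1,c_2,\ldots;d_1,d_2,\ldots)$ denotes the formal power series given by the Jacobi continued fraction $$\cfrac{1}{1-c_0x-\cfrac{d_1x^2}{1-c_1x-\cfrac{d_2x^2}{1-c_2x-\cdots}}}.$$ -}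

module Defs where

open import Level using (Level)
open import Algebra.Bundles using (CommutativeRing)
open import Data.Nat using (ℕ; zero; suc; _∸_; _≤_)
open import Data.Product using (Σ)

module Series {c ℓ : Level} (R : CommutativeRing c ℓ) where
  open CommutativeRing R

  FPS : Set c
  FPS = ℕ → Carrier

  natR : ℕ → Carrier
  natR zero = 0#
  natR (suc n) = 1# + natR n

  pw : Carrier → ℕ → Carrier
  pw r zero = 1#
  pw r (suc n) = r * pw r n

  sumTo : ℕ → (ℕ → Carrier) → Carrier
  sumTo zero f = 0#
  sumTo (suc n) f = sumTo n f + f n

  one : FPS
  one zero = 1#
  one (suc n) = 0#

  _⋆_ : FPS → FPS → FPS
  (f ⋆ g) n = sumTo (suc n) (λ i → f i * g (n ∸ i))

  xmul : FPS → FPS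
  xmul f zero = 0#
  xmul f (suc n) = f n

  spow : FPS → ℕ → FPS
  spow h zero = one
  spow h (suc m) = h ⋆ spow h m

  -- 1/(1 - h) for a series h with zero constant term:
  -- coefficient n of  Σ_{m ≥ 0} h^m  (only m ≤ n contribute when h 0 = 0)
  invOneMinus : FPS → FPS
  invOneMinus h n = sumTo (suc n) (λ m → spow h m n)

  -- exp(t x) = Σ t^n x^n / n!, where fi n is a given inverse of n! in R
  expS : (ℕ → Carrier) → Carrier → FPS
  expS fi t n = pw t n * fi n

  egf : (ℕ → Carrier) → (ℕ → Carrier) → FPS
  egf fi μ n = μ n * fi n

  -- Truncations of the J-fraction J(c_0,c_1,...; d_1,d_2,...):
  -- JTrunc c d 0 i = 1,
  -- JTrunc c d (k+1) i = 1 / (1 - c_i x - d_{i+1} x^2 · JTrunc c d k (i+1)).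
  -- The J-fraction is the x-adic limit of JTrunc c d k 0 as k → ∞.
  JTrunc : (ℕ → Carrier) → (ℕ → Carrier) → ℕ → ℕ → FPS
  JTrunc cs ds zero i = one
  JTrunc cs ds (suc k) i =
    invOneMinus (xmul (λ m → cs i * one m + ds (suc i) * xmul (JTrunc cs ds k (suc i)) m))

  -- "the formal power series Σ μ_n x^n equals J(c; d)": every coefficient
  -- of the truncations eventually agrees with μ (x-adic convergence).
  OGFisJ : (ℕ → Carrier) → (ℕ → Carrier) → (ℕ → Carrier) → Set ℓ
  OGFisJ μ cs ds = ∀ n → Σ ℕ (λ K → ∀ k → K ≤ k → JTrunc cs ds k 0 n ≈ μ n)

-- Put u = 1 − y, E = e^{bux}, P = (E − 1)/b, F = u e^{aux} and L = 1 − yE = u − ybP; the hypothesis says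
-- that the exponential generating function of μ is F/L. Since F' = au F, P' = uE and uE = L + bP, the
-- series S_k = F P^k / L^{k+1} satisfy the tridiagonal system
--   S_k' = k S_{k−1} + c_k S_k + (k+1) y b² S_{k+1},   c_k = au + kb + (k+1)yb = y(b − a) + a + kb(1 + y).
-- On the numbers n! [x^n] S_k / k! this is the recurrence of the Stieltjes table (weighted Motzkin paths)
-- with level weights c_k and fall weights d_k = k² b² y, whose column 0 is therefore μ. Finally, by the
-- first-step decomposition of Motzkin paths, the truncations of the J-fraction agree with that column
-- up to their order.
module Submission where

open import Defs
open import Algebra.Bundles using (CommutativeRing)
open import Data.Nat using (ℕ; zero; suc; _!; _∸_; _≤_; _<_; s≤s)
open import Data.Product using (Σ; _,_)
open import Data.Sum using (inj₁; inj₂)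

import Algebra.Solver.Ring
import Algebra.Solver.Ring.AlmostCommutativeRing as ACR
open import Data.Integer.Base as ℤ using (ℤ; +_; -[1+_]; _⊖_; sign; ∣_∣; _◃_)
import Data.Integer.Properties as ℤₚ
open import Data.Maybe.Base using (Maybe; just; nothing)
import Data.Nat as ℕ
import Data.Nat.Properties as ℕₚ
open import Data.Sign.Base as Sign using (Sign)
open import Level using (Level)
open import Relation.Binary.PropositionalEquality as ≡ using (_≡_)
open import Relation.Nullary using (yes; no)

∸-suc-< : ∀ {i n} → i < n → n ∸ suc i < n
∸-suc-< {i} {suc n} _ = s≤s (ℕₚ.m∸n≤m n i)

∸-comm : ∀ n i j → n ∸ i ∸ j ≡ n ∸ j ∸ i
∸-comm n i j = ≡.trans (ℕₚ.∸-+-assoc n i j) (≡.trans (≡.cong (n ∸_) (ℕₚ.+-comm i j)) (≡.sym (ℕₚ.∸-+-assoc n j i)))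

-- The library instantiates the ring solver with ℕ coefficients only, which cannot cancel x − x.
-- Through the optimised _×_, the constants con (+ 0) and con (+ 1) evaluate to 0# and 1# on the nose.
module IntegerSolver {c ℓ : Level} (R : CommutativeRing c ℓ) where
  open CommutativeRing R hiding (zero)
  open import Algebra.Properties.Ring ring using (-‿involutive; -0#≈0#; -1*x≈-x; -‿distribʳ-*)
  open import Algebra.Properties.AbelianGroup +-abelianGroup using (⁻¹-∙-comm)
  open import Algebra.Properties.Semiring.Mult.TCOptimised semiring using (_×_; ×-homo-+; ×1-homo-*; 1+×)
  open import Relation.Binary.Reasoning.Setoid setoid

  intR : ℤ → Carrier
  intR (+ n) = n × 1#
  intR -[1+ n ] = - (suc n × 1#)

  signR : Sign → Carrier
  signR Sign.+ = 1#
  signR Sign.- = - 1#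

  signR-homo-* : ∀ s t → signR (s Sign.* t) ≈ signR s * signR t
  signR-homo-* Sign.+ t = sym (*-identityˡ _)
  signR-homo-* Sign.- Sign.+ = sym (*-identityʳ _)
  signR-homo-* Sign.- Sign.- = begin
    1#              ≈⟨ sym (-‿involutive _) ⟩
    - - 1#          ≈⟨ -‿cong (sym (-1*x≈-x _)) ⟩
    - (- 1# * 1#)   ≈⟨ -‿distribʳ-* _ _ ⟩
    - 1# * - 1#     ∎

  intR-◃ : ∀ s n → intR (s ◃ n) ≈ signR s * (n × 1#)
  intR-◃ s zero = sym (zeroʳ _)
  intR-◃ Sign.+ (suc n) = sym (*-identityˡ _)
  intR-◃ Sign.- (suc n) = sym (-1*x≈-x _)

  intR-sign-abs : ∀ i → intR i ≈ signR (sign i) * (∣ i ∣ × 1#)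
  intR-sign-abs i = trans (reflexive (≡.cong intR (≡.sym (ℤₚ.◃-inverse i)))) (intR-◃ (sign i) ∣ i ∣)

  intR-homo-* : ∀ i j → intR (i ℤ.* j) ≈ intR i * intR j
  intR-homo-* i j = begin
    intR (i ℤ.* j)                                           ≈⟨ intR-◃ (sign i Sign.* sign j) (∣ i ∣ ℕ.* ∣ j ∣) ⟩
    signR (sign i Sign.* sign j) * ((∣ i ∣ ℕ.* ∣ j ∣) × 1#)  ≈⟨ *-cong (signR-homo-* (sign i) (sign j)) (×1-homo-* ∣ i ∣ ∣ j ∣) ⟩
    (si * sj) * (ni * nj)                                    ≈⟨ *-assoc _ _ _ ⟩
    si * (sj * (ni * nj))                                    ≈⟨ *-congˡ (trans (sym (*-assoc _ _ _)) (trans (*-congʳ (*-comm _ _)) (*-assoc _ _ _))) ⟩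
    si * (ni * (sj * nj))                                    ≈⟨ sym (*-assoc _ _ _) ⟩
    (si * ni) * (sj * nj)                                    ≈⟨ *-cong (sym (intR-sign-abs i)) (sym (intR-sign-abs j)) ⟩
    intR i * intR j                                          ∎
    where
    si sj ni nj : Carrier
    si = signR (sign i)
    sj = signR (sign j)
    ni = ∣ i ∣ × 1#
    nj = ∣ j ∣ × 1#

  intR-⊖ : ∀ m n → intR (m ⊖ n) ≈ m × 1# + - (n × 1#)
  intR-⊖ zero zero = sym (trans (+-congˡ -0#≈0#) (+-identityʳ _))
  intR-⊖ zero (suc n) = sym (+-identityˡ _)
  intR-⊖ (suc m) zero = sym (trans (+-congˡ -0#≈0#) (+-identityʳ _))
  intR-⊖ (suc m) (suc n) = begin
    intR (suc m ⊖ suc n)               ≈⟨ reflexive (≡.cong intR (ℤₚ.[1+m]⊖[1+n]≡m⊖n m n)) ⟩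
    intR (m ⊖ n)                       ≈⟨ intR-⊖ m n ⟩
    M + - N                            ≈⟨ sym (+-identityˡ _) ⟩
    0# + (M + - N)                     ≈⟨ +-congʳ (sym (-‿inverseʳ 1#)) ⟩
    (1# + - 1#) + (M + - N)            ≈⟨ +-assoc _ _ _ ⟩
    1# + (- 1# + (M + - N))            ≈⟨ +-congˡ (trans (sym (+-assoc _ _ _)) (trans (+-congʳ (+-comm _ _)) (+-assoc _ _ _))) ⟩
    1# + (M + (- 1# + - N))            ≈⟨ sym (+-assoc _ _ _) ⟩
    (1# + M) + (- 1# + - N)            ≈⟨ +-cong (sym (1+× m 1#)) (trans (⁻¹-∙-comm _ _) (-‿cong (sym (1+× n 1#)))) ⟩
    suc m × 1# + - (suc n × 1#)        ∎
    where
    M N : Carrier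
    M = m × 1#
    N = n × 1#

  intR-homo-+ : ∀ i j → intR (i ℤ.+ j) ≈ intR i + intR j
  intR-homo-+ (+ m) (+ n) = ×-homo-+ 1# m n
  intR-homo-+ (+ m) -[1+ n ] = intR-⊖ m (suc n)
  intR-homo-+ -[1+ m ] (+ n) = trans (intR-⊖ n (suc m)) (+-comm _ _)
  intR-homo-+ -[1+ m ] -[1+ n ] = begin
    - ((suc (suc m) ℕ.+ n) × 1#)              ≈⟨ -‿cong (reflexive (≡.cong (_× 1#) (≡.sym (ℕₚ.+-suc (suc m) n)))) ⟩
    - ((suc m ℕ.+ suc n) × 1#)                ≈⟨ -‿cong (×-homo-+ 1# (suc m) (suc n)) ⟩
    - (suc m × 1# + suc n × 1#)               ≈⟨ sym (⁻¹-∙-comm _ _) ⟩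
    - (suc m × 1#) + - (suc n × 1#)           ∎

  intR-homo-neg : ∀ i → intR (ℤ.- i) ≈ - intR i
  intR-homo-neg -[1+ n ] = sym (-‿involutive _)
  intR-homo-neg (+ zero) = sym -0#≈0#
  intR-homo-neg (+ suc n) = refl

  intR-morphism : ℤ.+-*-rawRing ACR.-Raw-AlmostCommutative⟶ ACR.fromCommutativeRing R
  intR-morphism = record
    { ⟦_⟧ = intR ; +-homo = intR-homo-+ ; *-homo = intR-homo-* ; -‿homo = intR-homo-neg
    ; 0-homo = refl ; 1-homo = refl }

  intR-≟ : ∀ i j → Maybe (intR i ≈ intR j)
  intR-≟ i j with i ℤₚ.≟ j
  ... | yes ≡.refl = just refl
  ... | no _ = nothing

  open Algebra.Solver.Ring ℤ.+-*-rawRing (ACR.fromCommutativeRing R) intR-morphism intR-≟ public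

module PowerSeriesRing {c ℓ : Level} (R : CommutativeRing c ℓ) where
  open CommutativeRing R hiding (zero)
  open Series R
  open import Algebra.Properties.Ring ring using (-‿distribˡ-*)
  open import Algebra.Structures using (IsCommutativeRing)
  open import Relation.Binary.Reasoning.Setoid setoid

  natR-homo-+ : ∀ m n → natR (m ℕ.+ n) ≈ natR m + natR n
  natR-homo-+ zero n = sym (+-identityˡ _)
  natR-homo-+ (suc m) n = trans (+-congˡ (natR-homo-+ m n)) (sym (+-assoc _ _ _))

  natR-homo-* : ∀ m n → natR (m ℕ.* n) ≈ natR m * natR n
  natR-homo-* zero n = sym (zeroˡ _)
  natR-homo-* (suc m) n = begin
    natR (n ℕ.+ m ℕ.* n)           ≈⟨ trans (natR-homo-+ n (m ℕ.* n)) (+-congˡ (natR-homo-* m n)) ⟩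
    natR n + natR m * natR n       ≈⟨ +-congʳ (sym (*-identityˡ _)) ⟩
    1# * natR n + natR m * natR n  ≈⟨ sym (distribʳ _ _ _) ⟩
    (1# + natR m) * natR n         ∎

  sumTo-cong : ∀ n {f g : ℕ → Carrier} → (∀ i → i < n → f i ≈ g i) → sumTo n f ≈ sumTo n g
  sumTo-cong zero e = refl
  sumTo-cong (suc n) e = +-cong (sumTo-cong n (λ i i<n → e i (ℕₚ.m<n⇒m<1+n i<n))) (e n ℕₚ.≤-refl)

  sumTo-+ : ∀ n (f g : ℕ → Carrier) → sumTo n (λ i → f i + g i) ≈ sumTo n f + sumTo n g
  sumTo-+ zero f g = sym (+-identityˡ _)
  sumTo-+ (suc n) f g = begin
    sumTo n (λ i → f i + g i) + (f n + g n)  ≈⟨ +-congʳ (sumTo-+ n f g) ⟩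
    (sumTo n f + sumTo n g) + (f n + g n)    ≈⟨ +-assoc _ _ _ ⟩
    sumTo n f + (sumTo n g + (f n + g n))    ≈⟨ +-congˡ (trans (sym (+-assoc _ _ _)) (trans (+-congʳ (+-comm _ _)) (+-assoc _ _ _))) ⟩
    sumTo n f + (f n + (sumTo n g + g n))    ≈⟨ sym (+-assoc _ _ _) ⟩
    (sumTo n f + f n) + (sumTo n g + g n)    ∎

  *-distribˡ-sumTo : ∀ n r (f : ℕ → Carrier) → r * sumTo n f ≈ sumTo n (λ i → r * f i)
  *-distribˡ-sumTo zero r f = zeroʳ r
  *-distribˡ-sumTo (suc n) r f = trans (distribˡ _ _ _) (+-congʳ (*-distribˡ-sumTo n r f))

  sumTo-zero : ∀ n (f : ℕ → Carrier) → (∀ i → i < n → f i ≈ 0#) → sumTo n f ≈ 0#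
  sumTo-zero n f e = trans (sumTo-cong n e) (sumTo-const0 n)
    where
    sumTo-const0 : ∀ n → sumTo n (λ _ → 0#) ≈ 0#
    sumTo-const0 zero = refl
    sumTo-const0 (suc n) = trans (+-identityʳ _) (sumTo-const0 n)

  sumTo-suc : ∀ n (f : ℕ → Carrier) → sumTo (suc n) f ≈ f 0 + sumTo n (λ i → f (suc i))
  sumTo-suc zero f = trans (+-identityˡ _) (sym (+-identityʳ _))
  sumTo-suc (suc n) f = trans (+-congʳ (sumTo-suc n f)) (+-assoc _ _ _)

  sumTo-reverse : ∀ n (f : ℕ → Carrier) → sumTo n f ≈ sumTo n (λ i → f (n ∸ suc i))
  sumTo-reverse zero f = refl
  sumTo-reverse (suc n) f = begin
    sumTo n f + f n                        ≈⟨ +-comm _ _ ⟩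
    f n + sumTo n f                        ≈⟨ +-congˡ (sumTo-reverse n f) ⟩
    f n + sumTo n (λ i → f (n ∸ suc i))    ≈⟨ sym (sumTo-suc n (λ i → f (n ∸ i))) ⟩
    sumTo (suc n) (λ i → f (n ∸ i))        ∎

  antidiagonal-reverse : ∀ n (F : ℕ → ℕ → Carrier) →
    sumTo (suc n) (λ i → F i (n ∸ i)) ≈ sumTo (suc n) (λ i → F (n ∸ i) i)
  antidiagonal-reverse n F = trans (sumTo-reverse (suc n) (λ i → F i (n ∸ i)))
    (sumTo-cong (suc n) (λ i i≤n → reflexive (≡.cong (F (n ∸ i)) (ℕₚ.m∸[m∸n]≡n (ℕₚ.≤-pred i≤n)))))

  triangleSum : ℕ → (ℕ → ℕ → Carrier) → Carrier
  triangleSum n F = sumTo (suc n) (λ i → sumTo (suc (n ∸ i)) (F i))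

  triangleSum-cong : ∀ n {F G : ℕ → ℕ → Carrier} → (∀ i j → F i j ≈ G i j) → triangleSum n F ≈ triangleSum n G
  triangleSum-cong n e = sumTo-cong (suc n) (λ i _ → sumTo-cong (suc (n ∸ i)) (λ j _ → e i j))

  triangleSum-suc : ∀ n F → triangleSum (suc n) F ≈ triangleSum n F + sumTo (suc (suc n)) (λ i → F i (suc n ∸ i))
  triangleSum-suc n F = begin
    sumTo (suc n) (λ i → sumTo (suc (suc n ∸ i)) (F i)) + sumTo (suc (n ∸ n)) (F (suc n))
      ≈⟨ +-cong (sumTo-cong (suc n) (λ i i≤n → reflexive (≡.cong (λ k → sumTo (suc k) (F i)) (ℕₚ.+-∸-assoc 1 (ℕₚ.≤-pred i≤n)))))
                (reflexive (≡.cong (λ k → sumTo (suc k) (F (suc n))) (ℕₚ.n∸n≡0 n))) ⟩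
    sumTo (suc n) (λ i → sumTo (suc (n ∸ i)) (F i) + F i (suc (n ∸ i))) + (0# + F (suc n) 0)
      ≈⟨ +-cong (sumTo-+ (suc n) _ _) (+-identityˡ _) ⟩
    (triangleSum n F + sumTo (suc n) (λ i → F i (suc (n ∸ i)))) + F (suc n) 0
      ≈⟨ +-assoc _ _ _ ⟩
    triangleSum n F + (sumTo (suc n) (λ i → F i (suc (n ∸ i))) + F (suc n) 0)
      ≈⟨ +-congˡ (+-cong (sumTo-cong (suc n) (λ i i≤n → reflexive (≡.cong (F i) (≡.sym (ℕₚ.+-∸-assoc 1 (ℕₚ.≤-pred i≤n))))))
                         (reflexive (≡.cong (F (suc n)) (≡.sym (ℕₚ.n∸n≡0 n))))) ⟩
    triangleSum n F + sumTo (suc (suc n)) (λ i → F i (suc n ∸ i))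
      ∎

  triangleSum-swap : ∀ n F → triangleSum n F ≈ triangleSum n (λ j i → F i j)
  triangleSum-swap zero F = refl
  triangleSum-swap (suc n) F = begin
    triangleSum (suc n) F
      ≈⟨ triangleSum-suc n F ⟩
    triangleSum n F + sumTo (suc (suc n)) (λ i → F i (suc n ∸ i))
      ≈⟨ +-cong (triangleSum-swap n F) (antidiagonal-reverse (suc n) F) ⟩
    triangleSum n (λ j i → F i j) + sumTo (suc (suc n)) (λ i → F (suc n ∸ i) i)
      ≈⟨ sym (triangleSum-suc n (λ j i → F i j)) ⟩
    triangleSum (suc n) (λ j i → F i j)
      ∎

  -- A record rather than a pointwise function type, so that both series can be inferred from an equation.
  infix 4 _≋_
  record _≋_ (f g : FPS) : Set ℓ where
    constructor mk≋
    field coeff : ∀ n → f n ≈ g n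
  open _≋_ public

  ≋-refl : ∀ {f} → f ≋ f
  ≋-refl = mk≋ (λ n → refl)

  ≋-trans : ∀ {f g h} → f ≋ g → g ≋ h → f ≋ h
  ≋-trans e e' = mk≋ (λ n → trans (coeff e n) (coeff e' n))

  infixl 6 _⊞_
  _⊞_ : FPS → FPS → FPS
  (f ⊞ g) n = f n + g n

  infix 25 ⊟_
  ⊟_ : FPS → FPS
  (⊟ f) n = - f n

  𝟘 : FPS
  𝟘 n = 0#

  ⋆-cong : ∀ {f f' g g'} → f ≋ f' → g ≋ g' → f ⋆ g ≋ f' ⋆ g'
  ⋆-cong e e' = mk≋ (λ n → sumTo-cong (suc n) (λ i _ → *-cong (coeff e i) (coeff e' (n ∸ i))))

  ⋆-congˡ : ∀ h {f g} → f ≋ g → h ⋆ f ≋ h ⋆ g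
  ⋆-congˡ h = ⋆-cong (≋-refl {h})

  ⋆-congʳ : ∀ h {f g} → f ≋ g → f ⋆ h ≋ g ⋆ h
  ⋆-congʳ h e = ⋆-cong e (≋-refl {h})

  ⋆-comm : ∀ f g → f ⋆ g ≋ g ⋆ f
  ⋆-comm f g = mk≋ (λ n → trans (antidiagonal-reverse n (λ i j → f i * g j)) (sumTo-cong (suc n) (λ i _ → *-comm _ _)))

  ⋆-identityˡ : ∀ f → one ⋆ f ≋ f
  ⋆-identityˡ f = mk≋ λ n → begin
    sumTo (suc n) (λ i → one i * f (n ∸ i))              ≈⟨ sumTo-suc n _ ⟩
    1# * f n + sumTo n (λ i → 0# * f (n ∸ suc i))       ≈⟨ +-cong (*-identityˡ _) (sumTo-zero n _ (λ i _ → zeroˡ _)) ⟩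
    f n + 0#                                             ≈⟨ +-identityʳ _ ⟩
    f n                                                  ∎

  ⋆-distribʳ : ∀ f g h → (g ⊞ h) ⋆ f ≋ (g ⋆ f) ⊞ (h ⋆ f)
  ⋆-distribʳ f g h = mk≋ (λ n → trans (sumTo-cong (suc n) (λ i _ → distribʳ _ _ _)) (sumTo-+ (suc n) _ _))

  ⋆-as-triangleSum : ∀ f g h n → (f ⋆ (g ⋆ h)) n ≈ triangleSum n (λ i j → f i * (g j * h (n ∸ i ∸ j)))
  ⋆-as-triangleSum f g h n = sumTo-cong (suc n) (λ i _ → *-distribˡ-sumTo (suc (n ∸ i)) (f i) _)

  ⋆-swap : ∀ f g h → f ⋆ (g ⋆ h) ≋ g ⋆ (f ⋆ h)
  ⋆-swap f g h = mk≋ λ n → begin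
    (f ⋆ (g ⋆ h)) n                                        ≈⟨ ⋆-as-triangleSum f g h n ⟩
    triangleSum n (λ i j → f i * (g j * h (n ∸ i ∸ j)))    ≈⟨ triangleSum-swap n _ ⟩
    triangleSum n (λ j i → f i * (g j * h (n ∸ i ∸ j)))    ≈⟨ triangleSum-cong n (λ j i → exchange n i j) ⟩
    triangleSum n (λ j i → g j * (f i * h (n ∸ j ∸ i)))    ≈⟨ sym (⋆-as-triangleSum g f h n) ⟩
    (g ⋆ (f ⋆ h)) n                                        ∎
    where
    exchange : ∀ n i j → f i * (g j * h (n ∸ i ∸ j)) ≈ g j * (f i * h (n ∸ j ∸ i))
    exchange n i j = begin
      f i * (g j * h (n ∸ i ∸ j))  ≈⟨ sym (*-assoc _ _ _) ⟩
      (f i * g j) * h (n ∸ i ∸ j)  ≈⟨ *-cong (*-comm _ _) (reflexive (≡.cong h (∸-comm n i j))) ⟩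
      (g j * f i) * h (n ∸ j ∸ i)  ≈⟨ *-assoc _ _ _ ⟩
      g j * (f i * h (n ∸ j ∸ i))  ∎

  ⋆-assoc : ∀ f g h → (f ⋆ g) ⋆ h ≋ f ⋆ (g ⋆ h)
  ⋆-assoc f g h = ≋-trans (⋆-comm (f ⋆ g) h) (≋-trans (⋆-swap h f g) (⋆-congˡ f (⋆-comm h g)))

  FPS-isCommutativeRing : IsCommutativeRing _≋_ _⊞_ _⋆_ ⊟_ 𝟘 one
  FPS-isCommutativeRing = record
    { isRing = record
      { +-isAbelianGroup = record
        { isGroup = record
          { isMonoid = record
            { isSemigroup = record
              { isMagma = record
                { isEquivalence = record { refl = ≋-refl ; sym = λ e → mk≋ (λ n → sym (coeff e n)) ; trans = ≋-trans }
                ; ∙-cong = λ e e' → mk≋ (λ n → +-cong (coeff e n) (coeff e' n)) }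
              ; assoc = λ f g h → mk≋ (λ n → +-assoc _ _ _) }
            ; identity = (λ f → mk≋ (λ n → +-identityˡ _)) , (λ f → mk≋ (λ n → +-identityʳ _)) }
          ; inverse = (λ f → mk≋ (λ n → -‿inverseˡ _)) , (λ f → mk≋ (λ n → -‿inverseʳ _))
          ; ⁻¹-cong = λ e → mk≋ (λ n → -‿cong (coeff e n)) }
        ; comm = λ f g → mk≋ (λ n → +-comm _ _) }
      ; *-cong = ⋆-cong
      ; *-assoc = ⋆-assoc
      ; *-identity = ⋆-identityˡ , (λ f → ≋-trans (⋆-comm f one) (⋆-identityˡ f))
      ; distrib = (λ f g h → ≋-trans (⋆-comm f (g ⊞ h)) (≋-trans (⋆-distribʳ f g h) (mk≋ (λ n → +-cong (coeff (⋆-comm g f) n) (coeff (⋆-comm h f) n)))))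
                , ⋆-distribʳ }
    ; *-comm = ⋆-comm }

  FPS-commutativeRing : CommutativeRing c ℓ
  FPS-commutativeRing = record { isCommutativeRing = FPS-isCommutativeRing }

  module PS = CommutativeRing FPS-commutativeRing
  module PS-Solver = IntegerSolver FPS-commutativeRing

  ⋆-head : ∀ f g → (f ⋆ g) 0 ≈ f 0 * g 0
  ⋆-head f g = +-identityˡ _

  ⋆-cong-upTo : ∀ h {f g} n → (∀ j → j ≤ n → f j ≈ g j) → (h ⋆ f) n ≈ (h ⋆ g) n
  ⋆-cong-upTo h n e = sumTo-cong (suc n) (λ i _ → *-congˡ (e (n ∸ i) (ℕₚ.m∸n≤m n i)))

  ⋆-suc : ∀ f g n → (f ⋆ g) (suc n) ≈ (f ⋆ (λ m → g (suc m))) n + f (suc n) * g 0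
  ⋆-suc f g n = +-cong (sumTo-cong (suc n) (λ i i≤n → *-congˡ (reflexive (≡.cong g (ℕₚ.+-∸-assoc 1 (ℕₚ.≤-pred i≤n))))))
                       (*-congˡ (reflexive (≡.cong g (ℕₚ.n∸n≡0 n))))

  ⋆-head≈0 : ∀ h f n → h 0 ≈ 0# → (h ⋆ f) n ≈ sumTo n (λ i → h (suc i) * f (n ∸ suc i))
  ⋆-head≈0 h f n h₀≈0 = begin
    (h ⋆ f) n                                                 ≈⟨ sumTo-suc n _ ⟩
    h 0 * f n + sumTo n (λ i → h (suc i) * f (n ∸ suc i))    ≈⟨ +-congʳ (trans (*-congʳ h₀≈0) (zeroˡ _)) ⟩
    0# + sumTo n (λ i → h (suc i) * f (n ∸ suc i))           ≈⟨ +-identityˡ _ ⟩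
    sumTo n (λ i → h (suc i) * f (n ∸ suc i))                ∎

  ⋆-scaleʳ : ∀ f g r n → (f ⋆ (λ m → r * g m)) n ≈ r * (f ⋆ g) n
  ⋆-scaleʳ f g r n = trans (sumTo-cong (suc n) (λ i _ → trans (sym (*-assoc _ _ _)) (trans (*-congʳ (*-comm _ _)) (*-assoc _ _ _))))
                           (sym (*-distribˡ-sumTo (suc n) r _))

  ⋆-distribˡ-+ : ∀ f g h n → (f ⋆ (λ m → g m + h m)) n ≈ (f ⋆ g) n + (f ⋆ h) n
  ⋆-distribˡ-+ f g h n = coeff (PS.distribˡ f g h) n

  ⋆-xmul-zero : ∀ f g → (f ⋆ xmul g) 0 ≈ 0#
  ⋆-xmul-zero f g = trans (+-identityˡ _) (zeroʳ _)

  ⋆-xmul-suc : ∀ f g n → (f ⋆ xmul g) (suc n) ≈ (f ⋆ g) n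
  ⋆-xmul-suc f g n = trans (⋆-suc f (xmul g) n) (trans (+-congˡ (zeroʳ _)) (+-identityʳ _))

  constS : Carrier → FPS
  constS r n = r * one n

  constS-⋆ : ∀ r f n → (constS r ⋆ f) n ≈ r * f n
  constS-⋆ r f n = begin
    (constS r ⋆ f) n                                                    ≈⟨ sumTo-suc n _ ⟩
    (r * 1#) * f n + sumTo n (λ i → (r * 0#) * f (n ∸ suc i))          ≈⟨ +-cong (*-congʳ (*-identityʳ _)) (sumTo-zero n _ (λ i _ → trans (*-congʳ (zeroʳ _)) (zeroˡ _))) ⟩
    r * f n + 0#                                                        ≈⟨ +-identityʳ _ ⟩
    r * f n                                                             ∎

  constS-cong : ∀ {r s} → r ≈ s → constS r ≋ constS s
  constS-cong e = mk≋ (λ n → *-congʳ e)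

  constS-homo-+ : ∀ r s → constS (r + s) ≋ constS r ⊞ constS s
  constS-homo-+ r s = mk≋ (λ n → distribʳ _ _ _)

  constS-homo-* : ∀ r s → constS (r * s) ≋ constS r ⋆ constS s
  constS-homo-* r s = mk≋ (λ n → trans (*-assoc _ _ _) (sym (constS-⋆ r (constS s) n)))

  constS-homo-neg : ∀ r → constS (- r) ≋ ⊟ constS r
  constS-homo-neg r = mk≋ (λ n → sym (-‿distribˡ-* _ _))

  constS-homo-1 : constS 1# ≋ one
  constS-homo-1 = mk≋ (λ n → *-identityˡ _)

  constS-homo-0 : constS 0# ≋ 𝟘
  constS-homo-0 = mk≋ (λ n → zeroˡ _)

  constS-natR-suc : ∀ m → constS (natR (suc m)) ≋ one ⊞ constS (natR m)
  constS-natR-suc m = PS.trans (constS-homo-+ 1# (natR m)) (PS.+-congʳ constS-homo-1)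

  ∂ : FPS → FPS
  ∂ f n = natR (suc n) * f (suc n)

  ∂-cong : ∀ {f g} → f ≋ g → ∂ f ≋ ∂ g
  ∂-cong e = mk≋ (λ n → *-congˡ (coeff e (suc n)))

  ∂-constS : ∀ r → ∂ (constS r) ≋ 𝟘
  ∂-constS r = mk≋ (λ n → trans (*-congˡ (zeroʳ _)) (zeroʳ _))

  ∂-one : ∂ one ≋ 𝟘
  ∂-one = mk≋ (λ n → zeroʳ _)

  ∂-⋆ : ∀ f g → ∂ (f ⋆ g) ≋ ∂ f ⋆ g ⊞ f ⋆ ∂ g
  ∂-⋆ f g = mk≋ λ n → begin
    natR (suc n) * sumTo (suc (suc n)) (λ i → f i * g (suc n ∸ i))
      ≈⟨ *-distribˡ-sumTo (suc (suc n)) _ _ ⟩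
    sumTo (suc (suc n)) (λ i → natR (suc n) * (f i * g (suc n ∸ i)))
      ≈⟨ sumTo-cong (suc (suc n)) (λ i i≤1+n → trans (*-congʳ (natR-split (ℕₚ.≤-pred i≤1+n))) (distribʳ _ _ _)) ⟩
    sumTo (suc (suc n)) (λ i → natR i * (f i * g (suc n ∸ i)) + natR (suc n ∸ i) * (f i * g (suc n ∸ i)))
      ≈⟨ sumTo-+ (suc (suc n)) _ _ ⟩
    sumTo (suc (suc n)) (λ i → natR i * (f i * g (suc n ∸ i))) + sumTo (suc (suc n)) (λ i → natR (suc n ∸ i) * (f i * g (suc n ∸ i)))
      ≈⟨ +-cong (differentiateLeft n) (differentiateRight n) ⟩
    (∂ f ⋆ g) n + (f ⋆ ∂ g) n
      ∎
    where
    natR-split : ∀ {i m} → i ≤ m → natR m ≈ natR i + natR (m ∸ i)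
    natR-split {i} i≤m = trans (reflexive (≡.cong natR (≡.sym (ℕₚ.m+[n∸m]≡n i≤m)))) (natR-homo-+ i _)
    differentiateLeft : ∀ n → sumTo (suc (suc n)) (λ i → natR i * (f i * g (suc n ∸ i))) ≈ (∂ f ⋆ g) n
    differentiateLeft n = begin
      sumTo (suc (suc n)) (λ i → natR i * (f i * g (suc n ∸ i)))
        ≈⟨ sumTo-suc (suc n) _ ⟩
      0# * (f 0 * g (suc n)) + sumTo (suc n) (λ i → natR (suc i) * (f (suc i) * g (n ∸ i)))
        ≈⟨ +-cong (zeroˡ _) (sumTo-cong (suc n) (λ i _ → sym (*-assoc _ _ _))) ⟩
      0# + (∂ f ⋆ g) n
        ≈⟨ +-identityˡ _ ⟩
      (∂ f ⋆ g) n
        ∎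
    differentiateRight : ∀ n → sumTo (suc (suc n)) (λ i → natR (suc n ∸ i) * (f i * g (suc n ∸ i))) ≈ (f ⋆ ∂ g) n
    differentiateRight n = begin
      sumTo (suc n) (λ i → natR (suc n ∸ i) * (f i * g (suc n ∸ i))) + natR (n ∸ n) * (f (suc n) * g (n ∸ n))
        ≈⟨ +-cong (sumTo-cong (suc n) (λ i i≤n → trans (trans (sym (*-assoc _ _ _)) (trans (*-congʳ (*-comm _ _)) (*-assoc _ _ _)))
                     (*-congˡ (reflexive (≡.cong (λ j → natR j * g j) (ℕₚ.+-∸-assoc 1 (ℕₚ.≤-pred i≤n)))))))
                  (trans (*-congʳ (reflexive (≡.cong natR (ℕₚ.n∸n≡0 n)))) (zeroˡ _)) ⟩
      (f ⋆ ∂ g) n + 0#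
        ≈⟨ +-identityʳ _ ⟩
      (f ⋆ ∂ g) n
        ∎


  pw-homo-* : ∀ r s n → pw (r * s) n ≈ pw r n * pw s n
  pw-homo-* r s zero = sym (*-identityˡ _)
  pw-homo-* r s (suc n) = begin
    (r * s) * pw (r * s) n         ≈⟨ *-congˡ (pw-homo-* r s n) ⟩
    (r * s) * (pw r n * pw s n)    ≈⟨ *-assoc _ _ _ ⟩
    r * (s * (pw r n * pw s n))    ≈⟨ *-congˡ (trans (sym (*-assoc _ _ _)) (trans (*-congʳ (*-comm _ _)) (*-assoc _ _ _))) ⟩
    r * (pw r n * (s * pw s n))    ≈⟨ sym (*-assoc _ _ _) ⟩
    (r * pw r n) * (s * pw s n)    ∎

  module FactorialInverse (fi : ℕ → Carrier) (fi-inverse : ∀ n → natR (n !) * fi n ≈ 1#) where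

    fi-zero : fi 0 ≈ 1#
    fi-zero = trans (sym (trans (*-congʳ (+-identityʳ 1#)) (*-identityˡ _))) (fi-inverse 0)

    fi-suc : ∀ n → natR (suc n) * fi (suc n) ≈ fi n
    fi-suc n = begin
      X                              ≈⟨ sym (*-identityˡ _) ⟩
      1# * X                         ≈⟨ *-congʳ (sym (trans (*-comm _ _) (fi-inverse n))) ⟩
      (fi n * natR (n !)) * X        ≈⟨ *-assoc _ _ _ ⟩
      fi n * (natR (n !) * X)        ≈⟨ *-congˡ X-inverse ⟩
      fi n * 1#                      ≈⟨ *-identityʳ _ ⟩
      fi n                           ∎
      where
      X = natR (suc n) * fi (suc n)
      X-inverse : natR (n !) * X ≈ 1#
      X-inverse = begin
        natR (n !) * (natR (suc n) * fi (suc n))  ≈⟨ sym (*-assoc _ _ _) ⟩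
        (natR (n !) * natR (suc n)) * fi (suc n)  ≈⟨ *-congʳ (trans (*-comm _ _) (sym (natR-homo-* (suc n) (n !)))) ⟩
        natR (suc n !) * fi (suc n)               ≈⟨ fi-inverse (suc n) ⟩
        1#                                        ∎

    factorial-∂ : ∀ f n → natR (suc n !) * f (suc n) ≈ natR (n !) * ∂ f n
    factorial-∂ f n = trans (*-congʳ (trans (natR-homo-* (suc n) (n !)) (*-comm _ _))) (*-assoc _ _ _)

    factorial-egf : ∀ μ n → natR (n !) * egf fi μ n ≈ μ n
    factorial-egf μ n = begin
      natR (n !) * (μ n * fi n)    ≈⟨ trans (*-congˡ (*-comm _ _)) (sym (*-assoc _ _ _)) ⟩
      (natR (n !) * fi n) * μ n    ≈⟨ trans (*-congʳ (fi-inverse n)) (*-identityˡ _) ⟩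
      μ n                          ∎

    ∂-expS : ∀ t → ∂ (expS fi t) ≋ constS t ⋆ expS fi t
    ∂-expS t = mk≋ λ n → begin
      natR (suc n) * ((t * pw t n) * fi (suc n))   ≈⟨ trans (*-congˡ (*-comm _ _)) (sym (*-assoc _ _ _)) ⟩
      (natR (suc n) * fi (suc n)) * (t * pw t n)   ≈⟨ *-congʳ (fi-suc n) ⟩
      fi n * (t * pw t n)                          ≈⟨ trans (*-comm _ _) (*-assoc _ _ _) ⟩
      t * (pw t n * fi n)                          ≈⟨ sym (constS-⋆ t (expS fi t) n) ⟩
      (constS t ⋆ expS fi t) n                     ∎

  module GeometricSeries (h : FPS) (h₀≈0 : h 0 ≈ 0#) where

    spow-vanish : ∀ m n → n < m → spow h m n ≈ 0#
    spow-vanish (suc m) n n≤m = trans (⋆-head≈0 h (spow h m) n h₀≈0)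
      (sumTo-zero n _ (λ i i<n → trans (*-congˡ (spow-vanish m (n ∸ suc i) (ℕₚ.<-≤-trans (∸-suc-< i<n) (ℕₚ.≤-pred n≤m)))) (zeroʳ _)))

    partialSum : ℕ → FPS
    partialSum N n = sumTo N (λ m → spow h m n)

    partialSum-stable : ∀ N n → n < N → partialSum N n ≈ invOneMinus h n
    partialSum-stable (suc N) n n<1+N with ℕₚ.m<1+n⇒m<n∨m≡n n<1+N
    ... | inj₂ ≡.refl = refl
    ... | inj₁ n<N = trans (+-cong (partialSum-stable N n n<N) (spow-vanish N n n<N)) (+-identityʳ _)

    partialSum-suc : ∀ N → partialSum (suc N) ≋ one ⊞ h ⋆ partialSum N
    partialSum-suc zero = mk≋ λ n → begin
      0# + one n                        ≈⟨ trans (+-identityˡ _) (sym (+-identityʳ _)) ⟩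
      one n + 0#                        ≈⟨ +-congˡ (sym (sumTo-zero (suc n) _ (λ i _ → zeroʳ _))) ⟩
      one n + (h ⋆ partialSum zero) n   ∎
    partialSum-suc (suc N) = mk≋ λ n → begin
      partialSum (suc N) n + spow h (suc N) n                    ≈⟨ +-congʳ (coeff (partialSum-suc N) n) ⟩
      (one n + (h ⋆ partialSum N) n) + (h ⋆ spow h N) n          ≈⟨ +-assoc _ _ _ ⟩
      one n + ((h ⋆ partialSum N) n + (h ⋆ spow h N) n)          ≈⟨ +-congˡ (sym (⋆-distribˡ-+ h (partialSum N) (spow h N) n)) ⟩
      one n + (h ⋆ partialSum (suc N)) n                         ∎

    invOneMinus-fixpoint : invOneMinus h ≋ one ⊞ h ⋆ invOneMinus h
    invOneMinus-fixpoint = mk≋ λ n → begin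
      invOneMinus h n                        ≈⟨ sym (partialSum-stable (suc (suc n)) n (s≤s (ℕₚ.n≤1+n n))) ⟩
      partialSum (suc (suc n)) n             ≈⟨ coeff (partialSum-suc (suc n)) n ⟩
      one n + (h ⋆ partialSum (suc n)) n     ≈⟨ +-congˡ (⋆-cong-upTo h n (λ j j≤n → partialSum-stable (suc n) j (s≤s j≤n))) ⟩
      one n + (h ⋆ invOneMinus h) n          ∎

  invOneMinus≈solution : ∀ h g G N → h 0 ≈ 0# → g 0 ≈ 0# → (∀ j → j < N → h j ≈ g j) →
                         G ≋ one ⊞ g ⋆ G → ∀ n → n < N → invOneMinus h n ≈ G n
  invOneMinus≈solution h g G N h₀≈0 g₀≈0 h≈g G-fix n n<N = below (suc n) n<N n ℕₚ.≤-refl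
    where
    I : FPS
    I = invOneMinus h
    step : ∀ m → m < N → (∀ j → j < m → I j ≈ G j) → I m ≈ G m
    step m m<N I≈G = begin
      I m                                                   ≈⟨ coeff (GeometricSeries.invOneMinus-fixpoint h h₀≈0) m ⟩
      one m + (h ⋆ I) m                                     ≈⟨ +-congˡ (⋆-head≈0 h I m h₀≈0) ⟩
      one m + sumTo m (λ i → h (suc i) * I (m ∸ suc i))    ≈⟨ +-congˡ (sumTo-cong m (λ i i<m →
                                                                 *-cong (h≈g (suc i) (ℕₚ.≤-trans (s≤s i<m) m<N))
                                                                        (I≈G (m ∸ suc i) (∸-suc-< i<m)))) ⟩
      one m + sumTo m (λ i → g (suc i) * G (m ∸ suc i))    ≈⟨ +-congˡ (sym (⋆-head≈0 g G m g₀≈0)) ⟩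
      one m + (g ⋆ G) m                                     ≈⟨ sym (coeff G-fix m) ⟩
      G m                                                   ∎
    below : ∀ n → n ≤ N → ∀ j → j < n → I j ≈ G j
    below (suc n) n<N j j<1+n with ℕₚ.m<1+n⇒m<n∨m≡n j<1+n
    ... | inj₁ j<n = below n (ℕₚ.<⇒≤ n<N) j j<n
    ... | inj₂ ≡.refl = step j n<N (below j (ℕₚ.<⇒≤ n<N))

module JacobiFraction {c ℓ : Level} (R : CommutativeRing c ℓ) where
  open CommutativeRing R hiding (zero)
  open Series R
  open PowerSeriesRing R
  open import Relation.Binary.Reasoning.Setoid setoid

  -- The weight of the Motzkin paths of length n from height 0 to height k, where a rise weighs 1,
  -- a level step at height k weighs cs k and a fall from height k weighs ds k.
  stieltjesTable : (ℕ → Carrier) → (ℕ → Carrier) → ℕ → ℕ → Carrier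
  stieltjesTable cs ds zero zero = 1#
  stieltjesTable cs ds zero (suc k) = 0#
  stieltjesTable cs ds (suc n) zero =
    cs 0 * stieltjesTable cs ds n 0 + ds 1 * stieltjesTable cs ds n 1
  stieltjesTable cs ds (suc n) (suc k) =
    stieltjesTable cs ds n k + cs (suc k) * stieltjesTable cs ds n (suc k) + ds (suc (suc k)) * stieltjesTable cs ds n (suc (suc k))

  column : (ℕ → Carrier) → (ℕ → Carrier) → ℕ → FPS
  column cs ds k n = stieltjesTable cs ds n k

  stieltjesTable-cong : ∀ {cs cs' ds ds'} → (∀ k → cs k ≈ cs' k) → (∀ k → ds k ≈ ds' k) →
                        ∀ n k → stieltjesTable cs ds n k ≈ stieltjesTable cs' ds' n k
  stieltjesTable-cong ec ed zero zero = refl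
  stieltjesTable-cong ec ed zero (suc k) = refl
  stieltjesTable-cong ec ed (suc n) zero =
    +-cong (*-cong (ec 0) (stieltjesTable-cong ec ed n 0)) (*-cong (ed 1) (stieltjesTable-cong ec ed n 1))
  stieltjesTable-cong ec ed (suc n) (suc k) =
    +-cong (+-cong (stieltjesTable-cong ec ed n k) (*-cong (ec _) (stieltjesTable-cong ec ed n _))) (*-cong (ed _) (stieltjesTable-cong ec ed n _))

  module PathDecomposition (cs ds : ℕ → Carrier) where
    cs↑ ds↑ : ℕ → Carrier
    cs↑ k = cs (suc k)
    ds↑ k = ds (suc k)

    T T↑ : ℕ → ℕ → Carrier
    T = stieltjesTable cs ds
    T↑ = stieltjesTable cs↑ ds↑

    G : FPS
    G = column cs ds 0

    ⋆-linear₂ : ∀ (A C : FPS) r s n → (G ⋆ (λ m → r * A m + s * C m)) n ≈ r * (G ⋆ A) n + s * (G ⋆ C) n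
    ⋆-linear₂ A C r s n = trans (⋆-distribˡ-+ G (λ m → r * A m) (λ m → s * C m) n) (+-cong (⋆-scaleʳ G A r n) (⋆-scaleʳ G C s n))

    -- Split a path ending at height k + 1 at its last visit to height 0.
    table-lastVisit : ∀ n k → T (suc n) (suc k) ≈ (G ⋆ column cs↑ ds↑ k) n
    table-lastVisit zero zero = begin
      1# + cs 1 * 0# + ds 2 * 0#    ≈⟨ +-cong (trans (+-congˡ (zeroʳ _)) (+-identityʳ _)) (zeroʳ _) ⟩
      1# + 0#                       ≈⟨ +-identityʳ _ ⟩
      1#                            ≈⟨ sym (trans (+-identityˡ _) (*-identityˡ _)) ⟩
      0# + 1# * 1#                  ∎
    table-lastVisit zero (suc k) = begin
      0# + cs (suc (suc k)) * 0# + ds (suc (suc (suc k))) * 0#  ≈⟨ +-cong (trans (+-congˡ (zeroʳ _)) (+-identityʳ _)) (zeroʳ _) ⟩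
      0# + 0#                                                    ≈⟨ +-identityʳ _ ⟩
      0#                                                         ≈⟨ sym (trans (+-identityˡ _) (zeroʳ _)) ⟩
      0# + 1# * 0#                                               ∎
    table-lastVisit (suc n) zero = begin
      G (suc n) + cs 1 * T (suc n) 1 + ds 2 * T (suc n) 2
        ≈⟨ +-cong (+-congˡ (*-congˡ (table-lastVisit n 0))) (*-congˡ (table-lastVisit n 1)) ⟩
      G (suc n) + cs 1 * (G ⋆ column cs↑ ds↑ 0) n + ds 2 * (G ⋆ column cs↑ ds↑ 1) n
        ≈⟨ trans (+-assoc _ _ _) (trans (+-comm _ _) (+-congˡ (sym (*-identityʳ _)))) ⟩
      (cs 1 * (G ⋆ column cs↑ ds↑ 0) n + ds 2 * (G ⋆ column cs↑ ds↑ 1) n) + G (suc n) * 1#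
        ≈⟨ +-congʳ (sym (⋆-linear₂ (column cs↑ ds↑ 0) (column cs↑ ds↑ 1) (cs 1) (ds 2) n)) ⟩
      (G ⋆ (λ m → cs 1 * T↑ m 0 + ds 2 * T↑ m 1)) n + G (suc n) * 1#
        ≈⟨ sym (⋆-suc G (column cs↑ ds↑ 0) n) ⟩
      (G ⋆ column cs↑ ds↑ 0) (suc n)
        ∎
    table-lastVisit (suc n) (suc k) = begin
      T (suc n) (suc k) + cs (suc (suc k)) * T (suc n) (suc (suc k)) + ds (suc (suc (suc k))) * T (suc n) (suc (suc (suc k)))
        ≈⟨ +-cong (+-cong (table-lastVisit n k) (*-congˡ (table-lastVisit n (suc k)))) (*-congˡ (table-lastVisit n (suc (suc k)))) ⟩
      (G ⋆ A) n + cs (suc (suc k)) * (G ⋆ B) n + ds (suc (suc (suc k))) * (G ⋆ C) n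
        ≈⟨ sym (trans (⋆-distribˡ-+ G (λ m → A m + cs (suc (suc k)) * B m) (λ m → ds (suc (suc (suc k))) * C m) n)
                      (+-cong (trans (⋆-distribˡ-+ G A (λ m → cs (suc (suc k)) * B m) n) (+-congˡ (⋆-scaleʳ G B _ n))) (⋆-scaleʳ G C _ n))) ⟩
      (G ⋆ (λ m → A m + (cs (suc (suc k)) * B m) + ds (suc (suc (suc k))) * C m)) n
        ≈⟨ sym (trans (+-congˡ (zeroʳ _)) (+-identityʳ _)) ⟩
      (G ⋆ (λ m → A m + (cs (suc (suc k)) * B m) + ds (suc (suc (suc k))) * C m)) n + G (suc n) * 0#
        ≈⟨ sym (⋆-suc G B n) ⟩
      (G ⋆ B) (suc n)
        ∎
      where
      A B C : FPS
      A = column cs↑ ds↑ k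
      B = column cs↑ ds↑ (suc k)
      C = column cs↑ ds↑ (suc (suc k))


    firstStep : FPS
    firstStep = xmul (λ m → cs 0 * one m + ds 1 * xmul (column cs↑ ds↑ 0) m)

    column₀-fixpoint : G ≋ one ⊞ firstStep ⋆ G
    column₀-fixpoint = mk≋ coefficients
      where
      table-column₁ : ∀ n → T n 1 ≈ (G ⋆ xmul (column cs↑ ds↑ 0)) n
      table-column₁ zero = sym (⋆-xmul-zero G (column cs↑ ds↑ 0))
      table-column₁ (suc n) = trans (table-lastVisit n 0) (sym (⋆-xmul-suc G _ n))
      coefficients : ∀ n → G n ≈ (one ⊞ firstStep ⋆ G) n
      coefficients zero = sym (trans (+-congˡ (trans (+-identityˡ _) (zeroˡ _))) (+-identityʳ _))
      coefficients (suc n) = begin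
        cs 0 * G n + ds 1 * T n 1
          ≈⟨ +-cong (*-congˡ (sym (coeff (PS.*-identityʳ G) n))) (*-congˡ (table-column₁ n)) ⟩
        cs 0 * (G ⋆ one) n + ds 1 * (G ⋆ xmul (column cs↑ ds↑ 0)) n
          ≈⟨ sym (⋆-linear₂ one (xmul (column cs↑ ds↑ 0)) (cs 0) (ds 1) n) ⟩
        (G ⋆ (λ m → cs 0 * one m + ds 1 * xmul (column cs↑ ds↑ 0) m)) n
          ≈⟨ sym (⋆-xmul-suc G _ n) ⟩
        (G ⋆ firstStep) (suc n)
          ≈⟨ coeff (⋆-comm G firstStep) (suc n) ⟩
        (firstStep ⋆ G) (suc n)
          ≈⟨ sym (+-identityˡ _) ⟩
        0# + (firstStep ⋆ G) (suc n)
          ∎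

  module _ (cs ds : ℕ → Carrier) where

    jStep : ℕ → FPS → FPS
    jStep i X = xmul (λ m → cs i * one m + ds (suc i) * xmul X m)

    shiftedColumn₀ : ℕ → FPS
    shiftedColumn₀ i = column (λ k → cs (i ℕ.+ k)) (λ k → ds (i ℕ.+ k)) 0

    shiftedColumn₀-fixpoint : ∀ i → shiftedColumn₀ i ≋ one ⊞ jStep i (shiftedColumn₀ (suc i)) ⋆ shiftedColumn₀ i
    shiftedColumn₀-fixpoint i = PS.trans (PathDecomposition.column₀-fixpoint csᵢ dsᵢ) (PS.+-congˡ (⋆-congʳ (shiftedColumn₀ i) (mk≋ sameStep)))
      where
      csᵢ dsᵢ : ℕ → Carrier
      csᵢ k = cs (i ℕ.+ k)
      dsᵢ k = ds (i ℕ.+ k)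
      sameStep : ∀ n → PathDecomposition.firstStep csᵢ dsᵢ n ≈ jStep i (shiftedColumn₀ (suc i)) n
      sameStep zero = refl
      sameStep (suc zero) = +-cong (*-congʳ (reflexive (≡.cong cs (ℕₚ.+-identityʳ i)))) (*-congʳ (reflexive (≡.cong ds (ℕₚ.+-comm i 1))))
      sameStep (suc (suc m)) = +-cong (*-congʳ (reflexive (≡.cong cs (ℕₚ.+-identityʳ i))))
        (*-cong (reflexive (≡.cong ds (ℕₚ.+-comm i 1)))
                (stieltjesTable-cong (λ k → reflexive (≡.cong cs (ℕₚ.+-suc i k))) (λ k → reflexive (≡.cong ds (ℕₚ.+-suc i k))) m 0))

    JTrunc≈shiftedColumn₀ : ∀ k i n → n < k → JTrunc cs ds k i n ≈ shiftedColumn₀ i n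
    JTrunc≈shiftedColumn₀ (suc k) i = invOneMinus≈solution
      (jStep i (JTrunc cs ds k (suc i))) (jStep i (shiftedColumn₀ (suc i))) (shiftedColumn₀ i) (suc k)
      refl refl sameStep (shiftedColumn₀-fixpoint i)
      where
      sameStep : ∀ j → j < suc k → jStep i (JTrunc cs ds k (suc i)) j ≈ jStep i (shiftedColumn₀ (suc i)) j
      sameStep zero _ = refl
      sameStep (suc zero) _ = refl
      sameStep (suc (suc j)) j<k = +-congˡ (*-congˡ (JTrunc≈shiftedColumn₀ k (suc i) j (ℕₚ.<-trans (ℕₚ.n<1+n j) (ℕₚ.≤-pred j<k))))

    JTrunc≈stieltjesTable : ∀ k n → n < k → JTrunc cs ds k 0 n ≈ stieltjesTable cs ds n 0
    JTrunc≈stieltjesTable k = JTrunc≈shiftedColumn₀ k 0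

  -- For k = 0 the first term of the system vanishes, so S (pred 0) = S 0 there is immaterial.
  module DifferentialSystem
    (cs ds e : ℕ → Carrier) (ds≈ : ∀ k → ds (suc k) ≈ natR (suc k) * e k)
    (fi : ℕ → Carrier) (fi-inverse : ∀ n → natR (n !) * fi n ≈ 1#)
    (S : ℕ → FPS) (S₀-head : S 0 0 ≈ 1#) (S-head : ∀ k → S (suc k) 0 ≈ 0#)
    (S-system : ∀ k → ∂ (S k) ≋ constS (natR k) ⋆ S (ℕ.pred k) ⊞ constS (cs k) ⋆ S k ⊞ constS (e k) ⋆ S (suc k))
    where
    open FactorialInverse fi fi-inverse
    open IntegerSolver R using (solve; _:+_; _:*_; _:=_; con)

    T : ℕ → ℕ → Carrier
    T = stieltjesTable cs ds

    factorialCoeff : ℕ → ℕ → Carrier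
    factorialCoeff n k = natR (n !) * S k n

    S-system-coeff : ∀ k n → ∂ (S k) n ≈ natR k * S (ℕ.pred k) n + cs k * S k n + e k * S (suc k) n
    S-system-coeff k n = trans (coeff (S-system k) n)
      (+-cong (+-cong (constS-⋆ _ (S (ℕ.pred k)) n) (constS-⋆ (cs k) (S k) n)) (constS-⋆ (e k) (S (suc k)) n))

    ds-fi : ∀ k → ds (suc k) * fi (suc k) ≈ fi k * e k
    ds-fi k = begin
      ds (suc k) * fi (suc k)               ≈⟨ *-congʳ (trans (ds≈ k) (*-comm _ _)) ⟩
      (e k * natR (suc k)) * fi (suc k)     ≈⟨ *-assoc _ _ _ ⟩
      e k * (natR (suc k) * fi (suc k))     ≈⟨ trans (*-congˡ (fi-suc k)) (*-comm _ _) ⟩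
      fi k * e k                            ∎

    factorialCoeff-suc : ∀ k n → fi k * factorialCoeff (suc n) k ≈ fi k * (natR (n !) * (natR k * S (ℕ.pred k) n + cs k * S k n + e k * S (suc k) n))
    factorialCoeff-suc k n = *-congˡ (trans (factorial-∂ (S k) n) (*-congˡ (S-system-coeff k n)))

    stieltjesTable≈factorialCoeff : ∀ n k → T n k ≈ fi k * factorialCoeff n k
    stieltjesTable≈factorialCoeff zero zero = sym (trans (*-cong fi-zero (trans (*-cong (+-identityʳ 1#) S₀-head) (*-identityˡ _))) (*-identityˡ _))
    stieltjesTable≈factorialCoeff zero (suc k) = sym (trans (*-congˡ (trans (*-congˡ (S-head k)) (zeroʳ _))) (zeroʳ _))
    stieltjesTable≈factorialCoeff (suc n) zero = begin
      cs 0 * T n 0 + ds 1 * T n 1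
        ≈⟨ +-cong (*-congˡ (stieltjesTable≈factorialCoeff n 0)) (trans (*-congˡ (stieltjesTable≈factorialCoeff n 1)) (trans (sym (*-assoc _ _ _)) (*-congʳ (ds-fi 0)))) ⟩
      cs 0 * (fi 0 * factorialCoeff n 0) + (fi 0 * e 0) * factorialCoeff n 1
        ≈⟨ solve 6 (λ C F N S₀ E S₁ → C :* (F :* (N :* S₀)) :+ (F :* E) :* (N :* S₁) := F :* (N :* (con (+ 0) :* S₀ :+ C :* S₀ :+ E :* S₁)))
                 refl (cs 0) (fi 0) (natR (n !)) (S 0 n) (e 0) (S 1 n) ⟩
      fi 0 * (natR (n !) * (0# * S 0 n + cs 0 * S 0 n + e 0 * S 1 n))
        ≈⟨ sym (factorialCoeff-suc 0 n) ⟩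
      fi 0 * factorialCoeff (suc n) 0
        ∎
    stieltjesTable≈factorialCoeff (suc n) (suc k) = begin
      T n k + cs (suc k) * T n (suc k) + ds (suc (suc k)) * T n (suc (suc k))
        ≈⟨ +-cong (+-cong (trans (stieltjesTable≈factorialCoeff n k) (*-congʳ (sym (fi-suc k)))) (*-congˡ (stieltjesTable≈factorialCoeff n (suc k))))
                  (trans (*-congˡ (stieltjesTable≈factorialCoeff n (suc (suc k)))) (trans (sym (*-assoc _ _ _)) (*-congʳ (ds-fi (suc k))))) ⟩
      (natR (suc k) * fi (suc k)) * factorialCoeff n k + cs (suc k) * (fi (suc k) * factorialCoeff n (suc k)) + (fi (suc k) * e (suc k)) * factorialCoeff n (suc (suc k))
        ≈⟨ solve 8 (λ K F N S₀ C S₁ E S₂ → (K :* F) :* (N :* S₀) :+ C :* (F :* (N :* S₁)) :+ (F :* E) :* (N :* S₂)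
                                             := F :* (N :* (K :* S₀ :+ C :* S₁ :+ E :* S₂)))
                 refl (natR (suc k)) (fi (suc k)) (natR (n !)) (S k n) (cs (suc k)) (S (suc k) n) (e (suc k)) (S (suc (suc k)) n) ⟩
      fi (suc k) * (natR (n !) * (natR (suc k) * S k n + cs (suc k) * S (suc k) n + e (suc k) * S (suc (suc k)) n))
        ≈⟨ sym (factorialCoeff-suc (suc k) n) ⟩
      fi (suc k) * factorialCoeff (suc n) (suc k)
        ∎

module DerivativeRules {c ℓ : Level} (R : CommutativeRing c ℓ) where
  open Series R
  open PowerSeriesRing R
  open PS-Solver using (solve; _:+_; _:*_; _:=_; con)
  open import Relation.Binary.Reasoning.Setoid PS.setoid

  ∂-⋆₃ : ∀ f g h → ∂ ((f ⋆ g) ⋆ h) ≋ (∂ f ⋆ g) ⋆ h ⊞ (f ⋆ ∂ g) ⋆ h ⊞ (f ⋆ g) ⋆ ∂ h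
  ∂-⋆₃ f g h = PS.trans (∂-⋆ (f ⋆ g) h) (PS.+-congʳ (PS.trans (⋆-congʳ h (∂-⋆ f g)) (PS.distribʳ h (∂ f ⋆ g) (f ⋆ ∂ g))))

  ∂-spow : ∀ f m → ∂ (spow f (suc m)) ≋ constS (natR (suc m)) ⋆ (spow f m ⋆ ∂ f)
  ∂-spow f zero = begin
    ∂ (f ⋆ one)                     ≈⟨ PS.trans (∂-⋆ f one) (PS.+-congˡ (PS.*-congˡ ∂-one)) ⟩
    ∂ f ⋆ one ⊞ f ⋆ 𝟘               ≈⟨ solve 2 (λ F DF → DF :* con (+ 1) :+ F :* con (+ 0) := con (+ 1) :* (con (+ 1) :* DF)) PS.refl f (∂ f) ⟩
    one ⋆ (one ⋆ ∂ f)               ≈⟨ ⋆-congʳ (one ⋆ ∂ f) (PS.sym (PS.trans (constS-natR-suc 0) (PS.trans (PS.+-congˡ constS-homo-0) (PS.+-identityʳ one)))) ⟩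
    constS (natR 1) ⋆ (one ⋆ ∂ f)   ∎
  ∂-spow f (suc m) = begin
    ∂ (f ⋆ spow f (suc m))
      ≈⟨ PS.trans (∂-⋆ f (spow f (suc m))) (PS.+-congˡ (PS.*-congˡ (∂-spow f m))) ⟩
    ∂ f ⋆ (f ⋆ spow f m) ⊞ f ⋆ (N ⋆ (spow f m ⋆ ∂ f))
      ≈⟨ solve 4 (λ F DF Q N → DF :* (F :* Q) :+ F :* (N :* (Q :* DF)) := (con (+ 1) :+ N) :* ((F :* Q) :* DF)) PS.refl f (∂ f) (spow f m) N ⟩
    (one ⊞ N) ⋆ (spow f (suc m) ⋆ ∂ f)
      ≈⟨ ⋆-congʳ (spow f (suc m) ⋆ ∂ f) (PS.sym (constS-natR-suc (suc m))) ⟩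
    constS (natR (suc (suc m))) ⋆ (spow f (suc m) ⋆ ∂ f)
      ∎
    where
    N = constS (natR (suc m))

module EulerianSeries {c ℓ : Level} (R : CommutativeRing c ℓ) where
  open CommutativeRing R hiding (zero)
  open Series R

  module Construction (a b y : Carrier) (fi : ℕ → Carrier) (fi-inverse : ∀ n → natR (n !) * fi n ≈ 1#)
                      (z : Carrier) (uz≈1 : (1# + - y) * z ≈ 1#) where
    open PowerSeriesRing R
    open FactorialInverse fi fi-inverse
    open DerivativeRules R

    u : Carrier
    u = 1# + - y

    E : FPS
    E = expS fi (b * u)

    -- (E − 1) / b, with the division by b carried out on the coefficients.
    P : FPS
    P zero = 0#
    P (suc n) = pw b n * pw u (suc n) * fi (suc n)

    F : FPS
    F = constS u ⋆ expS fi (a * u)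

    L : FPS
    L m = one m + - (y * E m)

    -- L = u − y b P, so its inverse is z / (1 − y z b P) with z = 1/u.
    L⁻¹ : FPS
    L⁻¹ = constS z ⋆ invOneMinus (constS (y * z * b) ⋆ P)

    S : ℕ → FPS
    S k = (F ⋆ spow P k) ⋆ spow L⁻¹ (suc k)

    cs : ℕ → Carrier
    cs n = y * (b + - a) + a + natR n * b * (1# + y)

    ds : ℕ → Carrier
    ds n = natR n * natR n * b * b * y

    e : ℕ → Carrier
    e k = natR (suc k) * (y * b) * b

    module _ where
      open import Relation.Binary.Reasoning.Setoid setoid
      open IntegerSolver R using (solve; _:+_; _:*_; :-_; _:=_; con)

      E≋ : E ≋ one ⊞ constS b ⋆ P
      E≋ = mk≋ λ where
        zero → begin
          1# * fi 0           ≈⟨ trans (*-identityˡ _) fi-zero ⟩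
          1#                  ≈⟨ sym (trans (+-congˡ (zeroʳ b)) (+-identityʳ _)) ⟩
          1# + b * 0#         ≈⟨ +-congˡ (sym (constS-⋆ b P 0)) ⟩
          1# + (constS b ⋆ P) 0 ∎
        (suc n) → begin
          ((b * u) * pw (b * u) n) * fi (suc n)         ≈⟨ *-congʳ (*-congˡ (pw-homo-* b u n)) ⟩
          ((b * u) * (pw b n * pw u n)) * fi (suc n)    ≈⟨ solve 5 (λ B U Pb Pu F → ((B :* U) :* (Pb :* Pu)) :* F := con (+ 0) :+ B :* ((Pb :* (U :* Pu)) :* F))
                                                              refl b u (pw b n) (pw u n) (fi (suc n)) ⟩
          0# + b * P (suc n)                            ≈⟨ +-congˡ (sym (constS-⋆ b P (suc n))) ⟩
          0# + (constS b ⋆ P) (suc n)                   ∎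

      ∂P : ∂ P ≋ constS u ⋆ E
      ∂P = mk≋ λ n → begin
        natR (suc n) * ((pw b n * (u * pw u n)) * fi (suc n))
          ≈⟨ solve 5 (λ N Pb U Pu F → N :* ((Pb :* (U :* Pu)) :* F) := U :* ((Pb :* Pu) :* (N :* F))) refl (natR (suc n)) (pw b n) u (pw u n) (fi (suc n)) ⟩
        u * ((pw b n * pw u n) * (natR (suc n) * fi (suc n)))
          ≈⟨ *-congˡ (*-cong (sym (pw-homo-* b u n)) (fi-suc n)) ⟩
        u * E n
          ≈⟨ sym (constS-⋆ u E n) ⟩
        (constS u ⋆ E) n
          ∎

      ∂L : ∂ L ≋ ⊟ (constS (y * b) ⋆ (constS u ⋆ E))
      ∂L = mk≋ λ n → begin
        natR (suc n) * (0# + - (y * E (suc n)))     ≈⟨ solve 3 (λ N Y X → N :* (con (+ 0) :+ :- (Y :* X)) := :- (Y :* (N :* X))) refl (natR (suc n)) y (E (suc n)) ⟩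
        - (y * ∂ E n)                               ≈⟨ -‿cong (*-congˡ (trans (coeff (∂-expS (b * u)) n) (constS-⋆ (b * u) E n))) ⟩
        - (y * ((b * u) * E n))                     ≈⟨ -‿cong (solve 4 (λ Y B U X → Y :* ((B :* U) :* X) := (Y :* B) :* (U :* X)) refl y b u (E n)) ⟩
        - ((y * b) * (u * E n))                     ≈⟨ -‿cong (sym (trans (constS-⋆ (y * b) (constS u ⋆ E) n) (*-congˡ (constS-⋆ u E n)))) ⟩
        - (constS (y * b) ⋆ (constS u ⋆ E)) n       ∎

      L≋ : L ≋ one ⊞ ⊟ (constS y ⋆ E)
      L≋ = mk≋ (λ n → +-congˡ (-‿cong (sym (constS-⋆ y E n))))

      S₀-head : S 0 0 ≈ 1#
      S₀-head = begin
        S 0 0                                   ≈⟨ ⋆-head (F ⋆ one) (L⁻¹ ⋆ one) ⟩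
        (F ⋆ one) 0 * (L⁻¹ ⋆ one) 0             ≈⟨ *-cong (trans (⋆-head F one) (*-identityʳ _)) (trans (⋆-head L⁻¹ one) (*-identityʳ _)) ⟩
        F 0 * L⁻¹ 0                             ≈⟨ *-cong (trans (constS-⋆ u (expS fi (a * u)) 0) (trans (*-congˡ (trans (*-identityˡ _) fi-zero)) (*-identityʳ u)))
                                                           (trans (constS-⋆ z (invOneMinus (constS (y * z * b) ⋆ P)) 0) (trans (*-congˡ (+-identityˡ _)) (*-identityʳ z))) ⟩
        u * z                                   ≈⟨ uz≈1 ⟩
        1#                                      ∎

      S-head : ∀ k → S (suc k) 0 ≈ 0#
      S-head k = begin
        S (suc k) 0                                              ≈⟨ ⋆-head (F ⋆ spow P (suc k)) (spow L⁻¹ (suc (suc k))) ⟩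
        (F ⋆ (P ⋆ spow P k)) 0 * spow L⁻¹ (suc (suc k)) 0        ≈⟨ *-congʳ (trans (⋆-head F (spow P (suc k))) (*-congˡ (⋆-head P (spow P k)))) ⟩
        (F 0 * (0# * spow P k 0)) * spow L⁻¹ (suc (suc k)) 0     ≈⟨ trans (*-congʳ (trans (*-congˡ (zeroˡ _)) (zeroʳ _))) (zeroˡ _) ⟩
        0#                                                       ∎

      cs≈ : ∀ k → cs k ≈ a * u + natR k * b + natR (suc k) * (y * b)
      cs≈ k = solve 4 (λ A B Y K → Y :* (B :+ :- A) :+ A :+ K :* B :* (con (+ 1) :+ Y)
                                   := A :* (con (+ 1) :+ :- Y) :+ K :* B :+ (con (+ 1) :+ K) :* (Y :* B))
                      refl a b y (natR k)

      ds≈ : ∀ k → ds (suc k) ≈ natR (suc k) * e k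
      ds≈ k = solve 3 (λ N B Y → N :* N :* B :* B :* Y := N :* (N :* (Y :* B) :* B)) refl (natR (suc k)) b y

    module _ where
      open import Relation.Binary.Reasoning.Setoid PS.setoid
      open import Algebra.Properties.Group PS.+-group using (inverseʳ-unique)
      open PS-Solver using (solve; _:+_; _:*_; :-_; _:=_; con)

      U Y B Z : FPS
      U = constS u
      Y = constS y
      B = constS b
      Z = constS z

      U≋ : U ≋ one ⊞ ⊟ Y
      U≋ = PS.trans (constS-homo-+ 1# (- y)) (PS.+-cong constS-homo-1 (constS-homo-neg y))

      L-expanded : L ≋ one ⊞ ⊟ (Y ⋆ (one ⊞ B ⋆ P))
      L-expanded = PS.trans L≋ (PS.+-congˡ (PS.-‿cong (⋆-congˡ Y E≋)))

      u⋆E≋L⊞b⋆P : U ⋆ E ≋ L ⊞ B ⋆ P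
      u⋆E≋L⊞b⋆P = begin
        U ⋆ E                                           ≈⟨ ⋆-cong U≋ E≋ ⟩
        (one ⊞ ⊟ Y) ⋆ (one ⊞ B ⋆ P)                     ≈⟨ solve 3 (λ Y B P → (con (+ 1) :+ :- Y) :* (con (+ 1) :+ B :* P)
                                                                    := (con (+ 1) :+ :- (Y :* (con (+ 1) :+ B :* P))) :+ B :* P) PS.refl Y B P ⟩
        (one ⊞ ⊟ (Y ⋆ (one ⊞ B ⋆ P))) ⊞ B ⋆ P          ≈⟨ PS.+-congʳ (PS.sym L-expanded) ⟩
        L ⊞ B ⋆ P                                       ∎

      L⁻¹-inverse : L ⋆ L⁻¹ ≋ one
      L⁻¹-inverse = begin
        L ⋆ (Z ⋆ I)
          ≈⟨ ⋆-congʳ (Z ⋆ I) L-expanded ⟩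
        (one ⊞ ⊟ (Y ⋆ (one ⊞ B ⋆ P))) ⋆ (Z ⋆ I)
          ≈⟨ solve 5 (λ Y Z B P I → (con (+ 1) :+ :- (Y :* (con (+ 1) :+ B :* P))) :* (Z :* I)
                                    := ((con (+ 1) :+ :- Y) :* Z) :* I :+ :- ((((Y :* Z) :* B) :* P) :* I)) PS.refl Y Z B P I ⟩
        ((one ⊞ ⊟ Y) ⋆ Z) ⋆ I ⊞ ⊟ ((((Y ⋆ Z) ⋆ B) ⋆ P) ⋆ I)
          ≈⟨ PS.+-cong (PS.trans (⋆-congʳ I (PS.trans (⋆-congʳ Z (PS.sym U≋)) U⋆Z≋1)) (PS.*-identityˡ I))
                       (PS.-‿cong (⋆-congʳ I (⋆-congʳ P (PS.sym (PS.trans (constS-homo-* (y * z) b) (⋆-congʳ B (constS-homo-* y z))))))) ⟩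
        I ⊞ ⊟ (h ⋆ I)
          ≈⟨ PS.+-congʳ (GeometricSeries.invOneMinus-fixpoint h h₀≈0) ⟩
        (one ⊞ h ⋆ I) ⊞ ⊟ (h ⋆ I)
          ≈⟨ solve 2 (λ O X → (O :+ X) :+ :- X := O) PS.refl one (h ⋆ I) ⟩
        one
          ∎
        where
        h I : FPS
        h = constS (y * z * b) ⋆ P
        I = invOneMinus h
        h₀≈0 : h 0 ≈ 0#
        h₀≈0 = trans (constS-⋆ (y * z * b) P 0) (zeroʳ _)
        U⋆Z≋1 : U ⋆ Z ≋ one
        U⋆Z≋1 = PS.trans (PS.sym (constS-homo-* u z)) (PS.trans (constS-cong uz≈1) constS-homo-1)

      u⋆E⋆L⁻¹ : (U ⋆ E) ⋆ L⁻¹ ≋ one ⊞ B ⋆ (P ⋆ L⁻¹)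
      u⋆E⋆L⁻¹ = begin
        (U ⋆ E) ⋆ L⁻¹               ≈⟨ ⋆-congʳ L⁻¹ u⋆E≋L⊞b⋆P ⟩
        (L ⊞ B ⋆ P) ⋆ L⁻¹           ≈⟨ PS.distribʳ L⁻¹ L (B ⋆ P) ⟩
        L ⋆ L⁻¹ ⊞ (B ⋆ P) ⋆ L⁻¹     ≈⟨ PS.+-cong L⁻¹-inverse (PS.*-assoc B P L⁻¹) ⟩
        one ⊞ B ⋆ (P ⋆ L⁻¹)         ∎

      ∂L⁻¹ : ∂ L⁻¹ ≋ constS (y * b) ⋆ (L⁻¹ ⋆ (one ⊞ B ⋆ (P ⋆ L⁻¹)))
      ∂L⁻¹ = begin
        ∂ L⁻¹                                        ≈⟨ PS.sym (PS.trans (⋆-congʳ (∂ L⁻¹) (PS.trans (⋆-comm L⁻¹ L) L⁻¹-inverse)) (PS.*-identityˡ (∂ L⁻¹))) ⟩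
        (L⁻¹ ⋆ L) ⋆ ∂ L⁻¹                            ≈⟨ PS.*-assoc L⁻¹ L (∂ L⁻¹) ⟩
        L⁻¹ ⋆ (L ⋆ ∂ L⁻¹)                            ≈⟨ ⋆-congˡ L⁻¹ (inverseʳ-unique (∂ L ⋆ L⁻¹) (L ⋆ ∂ L⁻¹) ∂[L⋆L⁻¹]≋0) ⟩
        L⁻¹ ⋆ ⊟ (∂ L ⋆ L⁻¹)                          ≈⟨ ⋆-congˡ L⁻¹ (PS.-‿cong (⋆-congʳ L⁻¹ ∂L)) ⟩
        L⁻¹ ⋆ ⊟ (⊟ (YB ⋆ (U ⋆ E)) ⋆ L⁻¹)             ≈⟨ solve 3 (λ L⁻¹ YB UE → L⁻¹ :* :- (:- (YB :* UE) :* L⁻¹) := YB :* (L⁻¹ :* (UE :* L⁻¹))) PS.refl L⁻¹ YB (U ⋆ E) ⟩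
        YB ⋆ (L⁻¹ ⋆ ((U ⋆ E) ⋆ L⁻¹))                 ≈⟨ ⋆-congˡ YB (⋆-congˡ L⁻¹ u⋆E⋆L⁻¹) ⟩
        YB ⋆ (L⁻¹ ⋆ (one ⊞ B ⋆ (P ⋆ L⁻¹)))           ∎
        where
        YB : FPS
        YB = constS (y * b)
        ∂[L⋆L⁻¹]≋0 : ∂ L ⋆ L⁻¹ ⊞ L ⋆ ∂ L⁻¹ ≋ 𝟘
        ∂[L⋆L⁻¹]≋0 = PS.trans (PS.sym (∂-⋆ L L⁻¹)) (PS.trans (∂-cong L⁻¹-inverse) ∂-one)

      ∂F : ∂ F ≋ constS (a * u) ⋆ F
      ∂F = begin
        ∂ (U ⋆ A)                          ≈⟨ PS.trans (∂-⋆ U A) (PS.+-cong (⋆-congʳ A (∂-constS u)) (⋆-congˡ U (∂-expS (a * u)))) ⟩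
        𝟘 ⋆ A ⊞ U ⋆ (constS (a * u) ⋆ A)   ≈⟨ solve 3 (λ U A AU → con (+ 0) :* A :+ U :* (AU :* A) := AU :* (U :* A)) PS.refl U A (constS (a * u)) ⟩
        constS (a * u) ⋆ (U ⋆ A)           ∎
        where
        A : FPS
        A = expS fi (a * u)

      N : ℕ → FPS
      N k = constS (natR k)

      leibniz-F : ∀ k → (∂ F ⋆ spow P k) ⋆ spow L⁻¹ (suc k) ≋ constS (a * u) ⋆ S k
      leibniz-F k = PS.trans (⋆-congʳ (spow L⁻¹ (suc k)) (⋆-congʳ (spow P k) ∂F))
        (solve 4 (λ AU F Pk Lk → (AU :* F :* Pk) :* Lk := AU :* ((F :* Pk) :* Lk)) PS.refl (constS (a * u)) F (spow P k) (spow L⁻¹ (suc k)))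

      leibniz-P : ∀ k → (F ⋆ ∂ (spow P k)) ⋆ spow L⁻¹ (suc k) ≋ N k ⋆ (S (ℕ.pred k) ⊞ B ⋆ S k)
      leibniz-P zero = begin
        (F ⋆ ∂ one) ⋆ L⁻¹¹            ≈⟨ ⋆-congʳ L⁻¹¹ (⋆-congˡ F ∂-one) ⟩
        (F ⋆ 𝟘) ⋆ L⁻¹¹                ≈⟨ solve 3 (λ F L X → (F :* con (+ 0)) :* L := con (+ 0) :* X) PS.refl F L⁻¹¹ (S 0 ⊞ B ⋆ S 0) ⟩
        𝟘 ⋆ (S 0 ⊞ B ⋆ S 0)           ≈⟨ ⋆-congʳ (S 0 ⊞ B ⋆ S 0) (PS.sym constS-homo-0) ⟩
        N 0 ⋆ (S 0 ⊞ B ⋆ S 0)         ∎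
        where
        L⁻¹¹ : FPS
        L⁻¹¹ = spow L⁻¹ 1
      leibniz-P (suc m) = begin
        (F ⋆ ∂ (spow P (suc m))) ⋆ (L⁻¹ ⋆ Lm)
          ≈⟨ ⋆-congʳ (L⁻¹ ⋆ Lm) (⋆-congˡ F (PS.trans (∂-spow P m) (⋆-congˡ (N (suc m)) (⋆-congˡ (spow P m) ∂P)))) ⟩
        (F ⋆ (N (suc m) ⋆ (spow P m ⋆ (U ⋆ E)))) ⋆ (L⁻¹ ⋆ Lm)
          ≈⟨ solve 6 (λ F N Pm UE L Lm → (F :* (N :* (Pm :* UE))) :* (L :* Lm) := N :* (((F :* Pm) :* Lm) :* (UE :* L)))
                   PS.refl F (N (suc m)) (spow P m) (U ⋆ E) L⁻¹ Lm ⟩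
        N (suc m) ⋆ (S m ⋆ ((U ⋆ E) ⋆ L⁻¹))
          ≈⟨ ⋆-congˡ (N (suc m)) (⋆-congˡ (S m) u⋆E⋆L⁻¹) ⟩
        N (suc m) ⋆ (S m ⋆ (one ⊞ B ⋆ (P ⋆ L⁻¹)))
          ≈⟨ solve 7 (λ N F Pm L Lm B P → N :* (((F :* Pm) :* Lm) :* (con (+ 1) :+ B :* (P :* L)))
                                          := N :* ((F :* Pm) :* Lm :+ B :* ((F :* (P :* Pm)) :* (L :* Lm))))
                   PS.refl (N (suc m)) F (spow P m) L⁻¹ Lm B P ⟩
        N (suc m) ⋆ (S m ⊞ B ⋆ S (suc m))
          ∎
        where
        Lm : FPS
        Lm = spow L⁻¹ (suc m)

      leibniz-L⁻¹ : ∀ k → (F ⋆ spow P k) ⋆ ∂ (spow L⁻¹ (suc k)) ≋ constS (natR (suc k) * (y * b)) ⋆ (S k ⊞ B ⋆ S (suc k))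
      leibniz-L⁻¹ k = begin
        (F ⋆ spow P k) ⋆ ∂ (spow L⁻¹ (suc k))
          ≈⟨ ⋆-congˡ (F ⋆ spow P k) (PS.trans (∂-spow L⁻¹ k) (⋆-congˡ (N (suc k)) (⋆-congˡ (spow L⁻¹ k) ∂L⁻¹))) ⟩
        (F ⋆ spow P k) ⋆ (N (suc k) ⋆ (spow L⁻¹ k ⋆ (YB ⋆ (L⁻¹ ⋆ (one ⊞ B ⋆ (P ⋆ L⁻¹))))))
          ≈⟨ solve 8 (λ F Pk N Lk YB L B P → (F :* Pk) :* (N :* (Lk :* (YB :* (L :* (con (+ 1) :+ B :* (P :* L))))))
                                             := (N :* YB) :* ((F :* Pk) :* (L :* Lk) :+ B :* ((F :* (P :* Pk)) :* (L :* (L :* Lk)))))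
                   PS.refl F (spow P k) (N (suc k)) (spow L⁻¹ k) YB L⁻¹ B P ⟩
        (N (suc k) ⋆ YB) ⋆ (S k ⊞ B ⋆ S (suc k))
          ≈⟨ ⋆-congʳ (S k ⊞ B ⋆ S (suc k)) (PS.sym (constS-homo-* (natR (suc k)) (y * b))) ⟩
        constS (natR (suc k) * (y * b)) ⋆ (S k ⊞ B ⋆ S (suc k))
          ∎
        where
        YB : FPS
        YB = constS (y * b)

      S-system : ∀ k → ∂ (S k) ≋ constS (natR k) ⋆ S (ℕ.pred k) ⊞ constS (cs k) ⋆ S k ⊞ constS (e k) ⋆ S (suc k)
      S-system k = begin
        ∂ (S k)
          ≈⟨ PS.trans (∂-⋆₃ F (spow P k) (spow L⁻¹ (suc k))) (PS.+-cong (PS.+-cong (leibniz-F k) (leibniz-P k)) (leibniz-L⁻¹ k)) ⟩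
        AU ⋆ S k ⊞ N k ⋆ (S (ℕ.pred k) ⊞ B ⋆ S k) ⊞ NYB ⋆ (S k ⊞ B ⋆ S (suc k))
          ≈⟨ solve 7 (λ AU N NYB B S₋ S S₊ → AU :* S :+ N :* (S₋ :+ B :* S) :+ NYB :* (S :+ B :* S₊)
                                            := N :* S₋ :+ (AU :+ N :* B :+ NYB) :* S :+ (NYB :* B) :* S₊)
                   PS.refl AU (N k) NYB B (S (ℕ.pred k)) (S k) (S (suc k)) ⟩
        N k ⋆ S (ℕ.pred k) ⊞ (AU ⊞ N k ⋆ B ⊞ NYB) ⋆ S k ⊞ (NYB ⋆ B) ⋆ S (suc k)
          ≈⟨ PS.+-cong (PS.+-congˡ (⋆-congʳ (S k) cs-split)) (⋆-congʳ (S (suc k)) (PS.sym (constS-homo-* _ b))) ⟩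
        N k ⋆ S (ℕ.pred k) ⊞ constS (cs k) ⋆ S k ⊞ constS (e k) ⋆ S (suc k)
          ∎
        where
        AU NYB : FPS
        AU = constS (a * u)
        NYB = constS (natR (suc k) * (y * b))
        cs-split : AU ⊞ N k ⋆ B ⊞ NYB ≋ constS (cs k)
        cs-split = PS.sym (PS.trans (constS-cong (cs≈ k))
          (PS.trans (constS-homo-+ _ _) (PS.+-congʳ (PS.trans (constS-homo-+ _ _) (PS.+-congˡ (constS-homo-* (natR k) b))))))

    module Moments (μ : ℕ → Carrier) (egf-equation : ∀ n → (egf fi μ ⋆ L) n ≈ u * expS fi (a * u) n) where
      open import Relation.Binary.Reasoning.Setoid PS.setoid
      open JacobiFraction R using (stieltjesTable; module DifferentialSystem)

      S₀≋egf : S 0 ≋ egf fi μ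
      S₀≋egf = begin
        (F ⋆ one) ⋆ (L⁻¹ ⋆ one)       ≈⟨ PS.*-cong (PS.*-identityʳ F) (PS.*-identityʳ L⁻¹) ⟩
        F ⋆ L⁻¹                       ≈⟨ ⋆-congʳ L⁻¹ (mk≋ (λ n → trans (constS-⋆ u (expS fi (a * u)) n) (sym (egf-equation n)))) ⟩
        (egf fi μ ⋆ L) ⋆ L⁻¹          ≈⟨ PS.*-assoc (egf fi μ) L L⁻¹ ⟩
        egf fi μ ⋆ (L ⋆ L⁻¹)          ≈⟨ ⋆-congˡ (egf fi μ) L⁻¹-inverse ⟩
        egf fi μ ⋆ one                ≈⟨ PS.*-identityʳ (egf fi μ) ⟩
        egf fi μ                      ∎

      stieltjesTable≈μ : ∀ n → stieltjesTable cs ds n 0 ≈ μ n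
      stieltjesTable≈μ n = trans (DifferentialSystem.stieltjesTable≈factorialCoeff cs ds e ds≈ fi fi-inverse S S₀-head S-head S-system n 0)
        (trans (trans (*-congʳ fi-zero) (*-identityˡ _)) (trans (*-congˡ (coeff S₀≋egf n)) (factorial-egf μ n)))

mainTheorem3 : ∀ {c ℓ} (R : CommutativeRing c ℓ) →
    let open CommutativeRing R
        open Series R
    in (a b y : Carrier) →
       (fi : ℕ → Carrier) → (∀ n → natR (n !) * fi n ≈ 1#) →
       Σ Carrier (λ z → (1# + - y) * z ≈ 1#) →
       (μ : ℕ → Carrier) →
       (∀ n → (egf fi μ ⋆ (λ m → one m + - (y * expS fi (b * (1# + - y)) m))) n
                ≈ (1# + - y) * expS fi (a * (1# + - y)) n) →
       OGFisJ μ
         (λ n → y * (b + - a) + a + natR n * b * (1# + y))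
         (λ n → natR n * natR n * b * b * y)
mainTheorem3 R a b y fi fi-inverse (z , uz≈1) μ egf-equation n =
  suc n , λ k n<k → CommutativeRing.trans R (JacobiFraction.JTrunc≈stieltjesTable R cs ds k n n<k) (stieltjesTable≈μ n)
  where
  open EulerianSeries.Construction R a b y fi fi-inverse z uz≈1
  open Moments μ egf-equation
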